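{- Let $r/s>1$ be a rational number with regular continued fraction expansion $[a_1,\ldots,a_{2m}]$ and negative continued fraction expansion $\llbracket c_1,\ldots,c_k\rrbracket$. Then $$\widetilde M^+_q(a_1,\ldots,a_{2m})=M_q(c_1,\ldots,c_k)\,R_q.$$
   Context: $q$ is a formal variable, $[a]_q=1+q+\cdots+q^{a-1}$, $[a]_{q^{ -1}}=1+q^{ -1}+\cdots+q^{ -(a-1)}$. Every rational $r/s>1$ has a unique expansion $r/s=a_1+\cfrac{1}{a_2+\cfrac{1}{\ddots+\cfrac{1}{a_{2m}}}}$ with an even number of integers $a_i\ge1$, and a unique expansion $r/s=c_1-\cfrac{1}{c_2-\cfrac{1}{\ddots-\cfrac{1}{c_k}}}$ with integers $c_i\ge 2$. Define $R_q=\begin{pmatrix}q&1\\0&1\end{pmatrix}$, $M_q(c_1,\ldots,c_k)=\prod_{i=1}^k\begin{pmatrix}[c_i]_q&-q^{c_i-1}\\1&0\end{pmatrix}$, $M^+_q(a_1,\ldots,a_{2m})=\prod_{j=1}^{m}\begin{pmatrix}[a_{2j-1}]_q&q^{a_{2j-1}}\\1&0\end{pmatrix}\begin{pmatrix}[a_{2j}]_{q^{ -1}}&q^{ -a_{2j}}\\1&0\end{pmatrix}$ (ordered products, left to right), and $\widetilde M^+_q(a_1,\ldots,a_{2m})=q^{a_2+a_4+\cdots+a_{2m}}M^+_q(a_1,\ldots,a_{2m})$. -}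

module Defs where

open import Level using (Level)
open import Data.Nat as ℕ using (ℕ; zero; suc; _∸_)
open import Data.Integer using (+_)
open import Data.List using (List; []; _∷_)
open import Data.Product using (_×_; _,_)
open import Relation.Nullary using (yes; no)
open import Data.Rational as ℚ using (ℚ; 0ℚ; 1/_; ≢-nonZero)
open import Data.Rational.Properties using (_≟_)
open import Algebra.Bundles using (CommutativeRing)

ℕ→ℚ : ℕ → ℚ
ℕ→ℚ n = + n ℚ./ 1

-- total reciprocal: 1/x for x ≠ 0 (the value at 0 is never used:
-- all tails of the expansions considered are > 0)
inv : ℚ → ℚ
inv x with x ≟ 0ℚ
... | yes _ = 0ℚ
... | no x≢0 = 1/_ x {{≢-nonZero x≢0}}

cf : List ℕ → ℚ
cf []           = 0ℚ
cf (a ∷ [])     = ℕ→ℚ a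
cf (a ∷ b ∷ as) = ℕ→ℚ a ℚ.+ inv (cf (b ∷ as))

ncf : List ℕ → ℚ
ncf []           = 0ℚ
ncf (c ∷ [])     = ℕ→ℚ c
ncf (c ∷ d ∷ cs) = ℕ→ℚ c ℚ.- inv (ncf (d ∷ cs))

-- 2×2 matrices over a commutative ring R, in which q is the formal
-- variable and qinv its inverse (so R plays the role of ℤ[q, q⁻¹]).

module _ {c ℓ : Level} (R : CommutativeRing c ℓ) where
  open CommutativeRing R

  record Mat2 : Set c where
    constructor mat
    field
      m11 m12 m21 m22 : Carrier
  open Mat2 public

  _⊗_ : Mat2 → Mat2 → Mat2
  A ⊗ B = mat (m11 A * m11 B + m12 A * m21 B) (m11 A * m12 B + m12 A * m22 B)
              (m21 A * m11 B + m22 A * m21 B) (m21 A * m12 B + m22 A * m22 B)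

  I₂ : Mat2
  I₂ = mat 1# 0# 0# 1#

  _·_ : Carrier → Mat2 → Mat2
  x · A = mat (x * m11 A) (x * m12 A) (x * m21 A) (x * m22 A)

  _≈M_ : Mat2 → Mat2 → Set ℓ
  A ≈M B = (m11 A ≈ m11 B) × (m12 A ≈ m12 B) × (m21 A ≈ m21 B) × (m22 A ≈ m22 B)

  pow : Carrier → ℕ → Carrier
  pow x zero    = 1#
  pow x (suc n) = x * pow x n

  qint : Carrier → ℕ → Carrier
  qint x zero    = 0#
  qint x (suc n) = qint x n + pow x n

  module _ (q qinv : Carrier) where

    Rq : Mat2
    Rq = mat q 1# 0# 1#

    Mq : List ℕ → Mat2
    Mq []       = I₂
    Mq (c ∷ cs) = mat (qint q c) (- pow q (c ∸ 1)) 1# 0# ⊗ Mq cs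

    -- M⁺_q(a₁,…,a_{2m}) = ∏_j ( [a_{2j-1}]_q  q^a_{2j-1} ; 1 0 )( [a_{2j}]_{q⁻¹}  q^(-a_{2j}) ; 1 0 )
    -- (only used on lists of even length; an odd trailing entry contributes
    --  only its first factor)
    Mplus : List ℕ → Mat2
    Mplus []           = I₂
    Mplus (a ∷ [])     = mat (qint q a) (pow q a) 1# 0#
    Mplus (a ∷ b ∷ as) =
      (mat (qint q a) (pow q a) 1# 0# ⊗ mat (qint qinv b) (pow qinv b) 1# 0#) ⊗ Mplus as

    evenSum : List ℕ → ℕ
    evenSum []           = 0
    evenSum (a ∷ [])     = 0
    evenSum (a ∷ b ∷ as) = b ℕ.+ evenSum as

    Mtplus : List ℕ → Mat2
    Mtplus as = pow q (evenSum as) · Mplus as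

-- Converting [a₁, …, a_{2m}] pair by pair gives the negative expansion
-- ⟦a₁ + 1, 2^(a₂-1), a₃ + 2, 2^(a₄-1), …, a_{2m-1} + 2, 2^(a_{2m}-1)⟧ of the same number
-- (2^k denotes k entries equal to 2). Negative expansions with all entries ≥ 2 are unique,
-- since ⟦c₁, c₂, …⟧ = c₁ - t with t = 1/⟦c₂, …⟧ in [0, 1); so c₁, …, c_k is that list.
-- On the matrix side, q^(a_{2j}) times the j-th pair of factors of M⁺_q equals
-- M_q(a_{2j-1} + 1, 2^(a_{2j}-1)) R_q, and R_q M_q(c, …) = M_q(c + 1, …) pushes each
-- R_q into the first entry of the next pair, which is why later pairs start with a_{2j-1} + 2.

module Submission where

open import Level using (Level)
open import Algebra.Bundles using (CommutativeRing)

module ℤ-CoefficientRingSolver {c ℓ : Level} (R : CommutativeRing c ℓ) where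

  open import Data.Nat as ℕ using (zero; suc)
  import Data.Nat.Properties as ℕ
  open import Data.Integer as ℤ using (ℤ; +_; -[1+_]; _⊖_)
  import Data.Integer.Properties as ℤ
  open import Data.Sign as Sign using ()
  open import Data.Maybe using (just; nothing)
  open import Relation.Nullary using (yes; no)
  open import Relation.Binary.PropositionalEquality as ≡ using ()
  open import Relation.Binary.Definitions using (WeaklyDecidable)
  open import Algebra.Solver.Ring.AlmostCommutativeRing
    using (_-Raw-AlmostCommutative⟶_; Induced-equivalence; fromCommutativeRing)

  open CommutativeRing R
  open import Algebra.Properties.Ring ring using (-‿distribˡ-*; -‿distribʳ-*; -‿involutive; -0#≈0#)
  open import Algebra.Properties.AbelianGroup +-abelianGroup using (⁻¹-∙-comm)
  open import Algebra.Properties.CommutativeSemigroup +-commutativeSemigroup using (interchange)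
  open import Algebra.Properties.Monoid.Mult.TCOptimised +-monoid using (_×_; ×-homo-+; 1+×)
  open import Algebra.Properties.Semiring.Mult.TCOptimised semiring using (×1-homo-*)
  open import Relation.Binary.Reasoning.Setoid setoid

  -- The solver compares normal forms by refl, so ⟦ 1ℤ ⟧ℤ must reduce to 1#: hence the
  -- optimised _×_, for which 1 × x = x.
  ⟦_⟧ℤ : ℤ → Carrier
  ⟦ + n ⟧ℤ      = n × 1#
  ⟦ -[1+ n ] ⟧ℤ = - (suc n × 1#)

  [1+x]-[1+y]≈x-y : ∀ x y → (1# + x) - (1# + y) ≈ x - y
  [1+x]-[1+y]≈x-y x y = begin
    (1# + x) - (1# + y)      ≈⟨ +-congˡ (⁻¹-∙-comm 1# y) ⟨
    (1# + x) + (- 1# + - y)  ≈⟨ interchange 1# x (- 1#) (- y) ⟩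
    (1# - 1#) + (x - y)      ≈⟨ +-congʳ (-‿inverseʳ 1#) ⟩
    0# + (x - y)             ≈⟨ +-identityˡ (x - y) ⟩
    x - y                    ∎

  ⊖-homo : ∀ m n → ⟦ m ⊖ n ⟧ℤ ≈ m × 1# - n × 1#
  ⊖-homo zero    zero    = sym (-‿inverseʳ 0#)
  ⊖-homo (suc m) zero    = sym (trans (+-congˡ -0#≈0#) (+-identityʳ _))
  ⊖-homo zero    (suc n) = sym (+-identityˡ _)
  ⊖-homo (suc m) (suc n) = begin
    ⟦ suc m ⊖ suc n ⟧ℤ             ≡⟨ ≡.cong ⟦_⟧ℤ (ℤ.[1+m]⊖[1+n]≡m⊖n m n) ⟩
    ⟦ m ⊖ n ⟧ℤ                     ≈⟨ ⊖-homo m n ⟩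
    m × 1# - n × 1#                ≈⟨ [1+x]-[1+y]≈x-y _ _ ⟨
    (1# + m × 1#) - (1# + n × 1#)  ≈⟨ +-cong (1+× m 1#) (-‿cong (1+× n 1#)) ⟨
    suc m × 1# - suc n × 1#        ∎

  ⟦+◃⟧ : ∀ n → ⟦ Sign.+ ℤ.◃ n ⟧ℤ ≈ n × 1#
  ⟦+◃⟧ n = reflexive (≡.cong ⟦_⟧ℤ (ℤ.+◃n≡+n n))

  ⟦-◃⟧ : ∀ n → ⟦ Sign.- ℤ.◃ n ⟧ℤ ≈ - (n × 1#)
  ⟦-◃⟧ zero    = sym -0#≈0#
  ⟦-◃⟧ (suc n) = refl

  ⟦⟧-+-homo : ∀ i j → ⟦ i ℤ.+ j ⟧ℤ ≈ ⟦ i ⟧ℤ + ⟦ j ⟧ℤ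
  ⟦⟧-+-homo (+ m)    (+ n)    = ×-homo-+ 1# m n
  ⟦⟧-+-homo (+ m)    -[1+ n ] = ⊖-homo m (suc n)
  ⟦⟧-+-homo -[1+ m ] (+ n)    = trans (⊖-homo n (suc m)) (+-comm _ _)
  ⟦⟧-+-homo -[1+ m ] -[1+ n ] = begin
    - (suc (suc (m ℕ.+ n)) × 1#)     ≡⟨ ≡.cong (λ k → - (suc k × 1#)) (ℕ.+-suc m n) ⟨
    - ((suc m ℕ.+ suc n) × 1#)       ≈⟨ -‿cong (×-homo-+ 1# (suc m) (suc n)) ⟩
    - (suc m × 1# + suc n × 1#)      ≈⟨ ⁻¹-∙-comm _ _ ⟨
    - (suc m × 1#) + - (suc n × 1#)  ∎

  ⟦⟧-*-homo : ∀ i j → ⟦ i ℤ.* j ⟧ℤ ≈ ⟦ i ⟧ℤ * ⟦ j ⟧ℤ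
  ⟦⟧-*-homo (+ m)    (+ n)    = trans (⟦+◃⟧ (m ℕ.* n)) (×1-homo-* m n)
  ⟦⟧-*-homo (+ m)    -[1+ n ] =
    trans (⟦-◃⟧ (m ℕ.* suc n)) (trans (-‿cong (×1-homo-* m (suc n))) (-‿distribʳ-* _ _))
  ⟦⟧-*-homo -[1+ m ] (+ n)    =
    trans (⟦-◃⟧ (suc m ℕ.* n)) (trans (-‿cong (×1-homo-* (suc m) n)) (-‿distribˡ-* _ _))
  ⟦⟧-*-homo -[1+ m ] -[1+ n ] = begin
    ⟦ Sign.+ ℤ.◃ suc m ℕ.* suc n ⟧ℤ  ≈⟨ ⟦+◃⟧ (suc m ℕ.* suc n) ⟩
    (suc m ℕ.* suc n) × 1#           ≈⟨ ×1-homo-* (suc m) (suc n) ⟩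
    x * y                            ≈⟨ -‿involutive (x * y) ⟨
    - - (x * y)                      ≈⟨ -‿cong (-‿distribˡ-* x y) ⟩
    - (- x * y)                      ≈⟨ -‿distribʳ-* (- x) y ⟩
    - x * - y                        ∎
    where x = suc m × 1#; y = suc n × 1#

  ⟦⟧-‿homo : ∀ i → ⟦ ℤ.- i ⟧ℤ ≈ - ⟦ i ⟧ℤ
  ⟦⟧-‿homo (+ zero)  = sym -0#≈0#
  ⟦⟧-‿homo (+ suc n) = refl
  ⟦⟧-‿homo -[1+ n ]  = sym (-‿involutive _)

  ℤ-morphism : ℤ.+-*-rawRing -Raw-AlmostCommutative⟶ fromCommutativeRing R
  ℤ-morphism = record
    { ⟦_⟧    = ⟦_⟧ℤ
    ; +-homo = ⟦⟧-+-homo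
    ; *-homo = ⟦⟧-*-homo
    ; -‿homo = ⟦⟧-‿homo
    ; 0-homo = refl
    ; 1-homo = refl
    }

  ℤ-≟ : WeaklyDecidable (Induced-equivalence ℤ-morphism)
  ℤ-≟ i j with i ℤ.≟ j
  ... | yes ≡.refl = just refl
  ... | no _       = nothing

  open import Algebra.Solver.Ring ℤ.+-*-rawRing (fromCommutativeRing R) ℤ-morphism ℤ-≟ public

module Expansions where

  open import Data.Nat as ℕ using (ℕ; zero; suc; s≤s; z≤n)
  import Data.Nat.Properties as ℕ
  open import Data.List using (List; []; _∷_; _++_; replicate; length)
  open import Data.List.Relation.Unary.All using (All; []; _∷_)
  open import Data.List.Relation.Unary.All.Properties using (++⁺)
  open import Relation.Binary.PropositionalEquality using (_≡_; trans)

  data EvenPositive : List ℕ → Set where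
    []      : EvenPositive []
    ⟨_,_⟩∷_ : ∀ a b {r} → EvenPositive r → EvenPositive (suc a ∷ suc b ∷ r)

  evenPositive : ∀ m as → length as ≡ 2 ℕ.* m → All (1 ℕ.≤_) as → EvenPositive as
  evenPositive zero    []                   _   _              = []
  evenPositive (suc m) (suc a ∷ suc b ∷ as) len (_ ∷ _ ∷ as≥1) =
    ⟨ a , b ⟩∷ evenPositive m as (ℕ.suc-injective (ℕ.suc-injective (trans len (ℕ.*-suc 2 m)))) as≥1
  evenPositive (suc m) (zero ∷ _)           _   (() ∷ _)
  evenPositive (suc m) (suc a ∷ zero ∷ _)   _   (_ ∷ () ∷ _)
  evenPositive (suc m) (suc a ∷ [])         len _ with () ← trans len (ℕ.*-suc 2 m)
  evenPositive (suc m) []                   len _ with () ← trans len (ℕ.*-suc 2 m)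

  twos : ℕ → List ℕ
  twos k = replicate k 2

  bump : List ℕ → List ℕ
  bump []       = []
  bump (c ∷ cs) = suc c ∷ cs

  negativeExpansion : ∀ {as} → EvenPositive as → List ℕ
  negativeExpansion []           = []
  negativeExpansion (⟨ a , b ⟩∷ e) = suc (suc a) ∷ twos b ++ bump (negativeExpansion e)

  negativeExpansion-≥2 : ∀ {as} (e : EvenPositive as) → All (2 ℕ.≤_) (negativeExpansion e)
  negativeExpansion-≥2 []           = []
  negativeExpansion-≥2 (⟨ a , b ⟩∷ e) = s≤s (s≤s z≤n) ∷ ++⁺ (twos-≥2 b) (bump-≥2 (negativeExpansion-≥2 e))
    where
    twos-≥2 : ∀ k → All (2 ℕ.≤_) (twos k)
    twos-≥2 zero    = []
    twos-≥2 (suc k) = ℕ.≤-refl ∷ twos-≥2 k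
    bump-≥2 : ∀ {cs} → All (2 ℕ.≤_) cs → All (2 ℕ.≤_) (bump cs)
    bump-≥2 []       = []
    bump-≥2 (p ∷ ps) = ℕ.m≤n⇒m≤1+n p ∷ ps

module ContinuedFractionValues where

  open import Defs using (ℕ→ℚ; inv; cf; ncf)
  open Expansions
  open import Data.Nat as ℕ using (ℕ; zero; suc; s≤s; z≤n)
  import Data.Nat.Properties as ℕ
  open import Data.Nat.Coprimality as Coprime using ()
  import Data.Integer as ℤ
  import Data.Integer.Properties as ℤ
  open import Data.List using (List; []; _∷_; _++_)
  open import Data.List.Properties using (++-identityʳ)
  open import Data.List.Relation.Unary.All using (All; []; _∷_)
  open import Data.Product using (_×_; _,_; proj₁; proj₂)
  open import Function using (_∘_)
  open import Data.Maybe using (Maybe; just; nothing)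
  open import Data.Empty using (⊥-elim)
  open import Relation.Nullary using (Dec; yes; no)
  open import Relation.Binary.PropositionalEquality
  open import Data.Rational using (ℚ; 0ℚ; 1ℚ; mkℚ; _+_; _*_; _-_; _<_; _≤_; *<*; *≤*; ≢-nonZero; positive; nonNegative)
  import Data.Rational.Properties as ℚ
  import Data.Rational.Unnormalised as ℚᵘ
  import Data.Rational.Unnormalised.Properties as ℚᵘ
  open import Tactic.RingSolver using (solve-∀)
  import Data.Integer.Tactic.RingSolver as ℤ-Solver
  open import Tactic.RingSolver.Core.AlmostCommutativeRing using (AlmostCommutativeRing; fromCommutativeRing)

  ℚ-ring : AlmostCommutativeRing _ _
  ℚ-ring = fromCommutativeRing ℚ.+-*-commutativeRing isZero
    where
    isZero : ∀ x → Maybe (0ℚ ≡ x)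
    isZero x with 0ℚ ℚ.≟ x
    ... | yes p = just p
    ... | no _  = nothing

  0<1 : 0ℚ < 1ℚ
  0<1 = ℚ.positive⁻¹ 1ℚ

  *-inv : ∀ {x} → x ≢ 0ℚ → x * inv x ≡ 1ℚ
  *-inv {x} x≢0 with x ℚ.≟ 0ℚ
  ... | yes x≡0 = ⊥-elim (x≢0 x≡0)
  ... | no  x≢0 = ℚ.*-inverseʳ x {{≢-nonZero x≢0}}

  inv-unique : ∀ x {y} → x * y ≡ 1ℚ → inv x ≡ y
  inv-unique x {y} xy≡1 = begin
    inv x              ≡⟨ ℚ.*-identityʳ (inv x) ⟨
    inv x * 1ℚ         ≡⟨ cong (inv x *_) xy≡1 ⟨
    inv x * (x * y)    ≡⟨ ℚ.*-assoc (inv x) x y ⟨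
    (inv x * x) * y    ≡⟨ cong (_* y) (trans (ℚ.*-comm (inv x) x) (*-inv x≢0)) ⟩
    1ℚ * y             ≡⟨ ℚ.*-identityˡ y ⟩
    y                  ∎
    where
    open ≡-Reasoning
    x≢0 : x ≢ 0ℚ
    x≢0 refl = ℚ.<⇒≢ 0<1 (trans (sym (ℚ.*-zeroˡ y)) xy≡1)

  -- inv 0ℚ = 0ℚ makes inv an involution of the whole of ℚ.
  inv-involutive : ∀ x → inv (inv x) ≡ x
  inv-involutive x = by-cases (x ℚ.≟ 0ℚ)
    where
    by-cases : Dec (x ≡ 0ℚ) → inv (inv x) ≡ x
    by-cases (yes refl) = refl
    by-cases (no x≢0)   = inv-unique (inv x) (trans (ℚ.*-comm (inv x) x) (*-inv x≢0))

  inv-pos : ∀ {x} → 0ℚ < x → 0ℚ < inv x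
  inv-pos {x} 0<x with x ℚ.≟ 0ℚ
  ... | yes refl = ⊥-elim (ℚ.<-irrefl refl 0<x)
  ... | no  x≢0  = ℚ.positive⁻¹ _ {{ℚ.1/pos⇒pos x {{positive 0<x}}}}

  inv-nonneg : ∀ {x} → 0ℚ ≤ x → 0ℚ ≤ inv x
  inv-nonneg {x} 0≤x with x ℚ.≟ 0ℚ
  ... | yes _   = ℚ.≤-refl
  ... | no  x≢0 = ℚ.<⇒≤ (ℚ.positive⁻¹ _ {{ℚ.1/pos⇒pos x {{pos}}}})
    where pos = ℚ.nonNeg∧nonZero⇒pos x {{nonNegative 0≤x}} {{≢-nonZero x≢0}}

  inv<1 : ∀ {x} → 1ℚ < x → inv x < 1ℚ
  inv<1 {x} 1<x = subst₂ _<_ (ℚ.*-identityˡ (inv x)) (*-inv (ℚ.<⇒≢ 0<x ∘ sym))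
                    (ℚ.*-monoˡ-<-pos (inv x) {{positive (inv-pos 0<x)}} 1<x)
    where
    0<x = ℚ.<-trans 0<1 1<x

  1-inv[1+inv[v]]≡inv[1+v] : ∀ {v} → 0ℚ < v → 1ℚ - inv (1ℚ + inv v) ≡ inv (1ℚ + v)
  1-inv[1+inv[v]]≡inv[1+v] {v} 0<v = sym (inv-unique (1ℚ + v) (begin
    (1ℚ + v) * (1ℚ - s)                                 ≡⟨ expand v t s ⟩
    1ℚ + v - s - v * ((1ℚ + t) * s) + (v * t) * s      ≡⟨ cong₂ (λ a b → 1ℚ + v - s - v * a + b * s) ts≡1 vt≡1 ⟩
    1ℚ + v - s - v * 1ℚ + 1ℚ * s                        ≡⟨ collapse v s ⟩
    1ℚ                                                  ∎))
    where
    open ≡-Reasoning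
    t = inv v
    s = inv (1ℚ + t)
    vt≡1 : v * t ≡ 1ℚ
    vt≡1 = *-inv (ℚ.<⇒≢ 0<v ∘ sym)
    ts≡1 : (1ℚ + t) * s ≡ 1ℚ
    ts≡1 = *-inv (λ e → ℚ.<⇒≢ (ℚ.+-mono-<-≤ 0<1 (ℚ.<⇒≤ (inv-pos 0<v))) (sym e))
    expand : ∀ v t s → (1ℚ + v) * (1ℚ - s) ≡ 1ℚ + v - s - v * ((1ℚ + t) * s) + (v * t) * s
    expand = solve-∀ ℚ-ring
    collapse : ∀ v s → 1ℚ + v - s - v * 1ℚ + 1ℚ * s ≡ 1ℚ
    collapse = solve-∀ ℚ-ring

  ℕ→ℚ≡mkℚ : ∀ n → ℕ→ℚ n ≡ mkℚ (ℤ.+ n) 0 (Coprime.sym (Coprime.1-coprimeTo n))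
  ℕ→ℚ≡mkℚ n = ℚ.normalize-coprime (Coprime.sym (Coprime.1-coprimeTo n))

  ℕ→ℚ-suc : ∀ n → ℕ→ℚ (suc n) ≡ 1ℚ + ℕ→ℚ n
  ℕ→ℚ-suc n rewrite ℕ→ℚ≡mkℚ (suc n) | ℕ→ℚ≡mkℚ n = ℚ.toℚᵘ-injective
    (ℚᵘ.≃-trans (ℚᵘ.*≡* (trans (cong (ℤ._* (ℤ.1ℤ ℤ.* ℤ.1ℤ)) (ℤ.pos-+ 1 n)) (denominators-1 (ℤ.+ n))))
                (ℚᵘ.≃-sym (ℚ.toℚᵘ-homo-+ 1ℚ (mkℚ (ℤ.+ n) 0 (Coprime.sym (Coprime.1-coprimeTo n))))))
    where
    denominators-1 : ∀ x → (ℤ.1ℤ ℤ.+ x) ℤ.* (ℤ.1ℤ ℤ.* ℤ.1ℤ) ≡ (ℤ.1ℤ ℤ.* ℤ.1ℤ ℤ.+ x ℤ.* ℤ.1ℤ) ℤ.* ℤ.1ℤ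
    denominators-1 = ℤ-Solver.solve-∀

  ℕ→ℚ-mono-≤ : ∀ {m n} → m ℕ.≤ n → ℕ→ℚ m ≤ ℕ→ℚ n
  ℕ→ℚ-mono-≤ {m} {n} m≤n rewrite ℕ→ℚ≡mkℚ m | ℕ→ℚ≡mkℚ n =
    *≤* (subst₂ ℤ._≤_ (sym (ℤ.*-identityʳ (ℤ.+ m))) (sym (ℤ.*-identityʳ (ℤ.+ n))) (ℤ.+≤+ m≤n))

  ℕ→ℚ-cancel-< : ∀ {m n} → ℕ→ℚ m < ℕ→ℚ n → m ℕ.< n
  ℕ→ℚ-cancel-< {m} {n} m<n rewrite ℕ→ℚ≡mkℚ m | ℕ→ℚ≡mkℚ n with m<n
  ... | *<* p = ℤ.drop‿+<+ (subst₂ ℤ._<_ (ℤ.*-identityʳ (ℤ.+ m)) (ℤ.*-identityʳ (ℤ.+ n)) p)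

  0<ℕ→ℚ-suc : ∀ n → 0ℚ < ℕ→ℚ (suc n)
  0<ℕ→ℚ-suc n = ℚ.<-≤-trans 0<1 (ℕ→ℚ-mono-≤ {1} {suc n} (s≤s z≤n))

  0≤ℕ→ℚ : ∀ n → 0ℚ ≤ ℕ→ℚ n
  0≤ℕ→ℚ n = ℕ→ℚ-mono-≤ {0} {n} z≤n

  -- inv 0ℚ = 0ℚ lets the last entry be read as followed by an empty tail.
  ncf-∷ : ∀ c cs → ncf (c ∷ cs) ≡ ℕ→ℚ c - inv (ncf cs)
  ncf-∷ c []       = sym (ℚ.+-identityʳ (ℕ→ℚ c))
  ncf-∷ c (d ∷ cs) = refl

  cf-∷ : ∀ a as → cf (a ∷ as) ≡ ℕ→ℚ a + inv (cf as)
  cf-∷ a []       = sym (ℚ.+-identityʳ (ℕ→ℚ a))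
  cf-∷ a (b ∷ as) = refl

  ncfWith : List ℕ → ℚ → ℚ
  ncfWith []       z = z
  ncfWith (c ∷ cs) z = ℕ→ℚ c - inv (ncfWith cs z)

  ncf-++ : ∀ xs ys → ncf (xs ++ ys) ≡ ncfWith xs (ncf ys)
  ncf-++ []       ys = refl
  ncf-++ (x ∷ xs) ys = trans (ncf-∷ x (xs ++ ys)) (cong (λ z → ℕ→ℚ x - inv z) (ncf-++ xs ys))

  ncf-bump : ∀ c cs → ncf (suc c ∷ cs) ≡ 1ℚ + ncf (c ∷ cs)
  ncf-bump c cs = begin
    ncf (suc c ∷ cs)                 ≡⟨ ncf-∷ (suc c) cs ⟩
    ℕ→ℚ (suc c) - inv (ncf cs)       ≡⟨ cong (_- inv (ncf cs)) (ℕ→ℚ-suc c) ⟩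
    1ℚ + ℕ→ℚ c - inv (ncf cs)        ≡⟨ ℚ.+-assoc 1ℚ (ℕ→ℚ c) _ ⟩
    1ℚ + (ℕ→ℚ c - inv (ncf cs))      ≡⟨ cong (λ z → 1ℚ + z) (ncf-∷ c cs) ⟨
    1ℚ + ncf (c ∷ cs)                ∎
    where open ≡-Reasoning

  cf-nonneg : ∀ as → 0ℚ ≤ cf as
  cf-nonneg []       = ℚ.≤-refl
  cf-nonneg (a ∷ as) = subst (0ℚ ≤_) (sym (cf-∷ a as))
    (ℚ.+-mono-≤ (0≤ℕ→ℚ a) (inv-nonneg (cf-nonneg as)))

  cf-pos : ∀ a as → 0ℚ < cf (suc a ∷ as)
  cf-pos a as = subst (0ℚ <_) (sym (cf-∷ (suc a) as))
    (ℚ.+-mono-<-≤ (0<ℕ→ℚ-suc a) (inv-nonneg (cf-nonneg as)))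

  0≤inv<1 : ∀ {x} → 1ℚ < x → 0ℚ ≤ inv x × inv x < 1ℚ
  0≤inv<1 1<x = ℚ.<⇒≤ (inv-pos (ℚ.<-trans 0<1 1<x)) , inv<1 1<x

  ncf>1 : ∀ {c cs} → All (2 ℕ.≤_) (c ∷ cs) → 1ℚ < ncf (c ∷ cs)
  0≤inv-ncf<1 : ∀ {cs} → All (2 ℕ.≤_) cs → 0ℚ ≤ inv (ncf cs) × inv (ncf cs) < 1ℚ

  ncf>1 {c} {cs} (2≤c ∷ cs≥2) = subst (1ℚ <_) (sym (ncf-∷ c cs))
    (ℚ.+-mono-≤-< (ℕ→ℚ-mono-≤ 2≤c) (ℚ.neg-antimono-< (proj₂ (0≤inv-ncf<1 cs≥2))))

  0≤inv-ncf<1 []        = ℚ.≤-refl , 0<1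
  0≤inv-ncf<1 (p ∷ ps) = 0≤inv<1 (ncf>1 (p ∷ ps))

  head-≤ : ∀ {c e s t} → ℕ→ℚ c - s ≡ ℕ→ℚ e - t → s < 1ℚ → 0ℚ ≤ t → c ℕ.≤ e
  head-≤ {c} {e} {s} {t} eq s<1 0≤t = ℕ.≤-pred (ℕ→ℚ-cancel-< (begin-strict
    ℕ→ℚ c                 ≡⟨ split (ℕ→ℚ c) s ⟩
    (ℕ→ℚ c - s) + s       ≡⟨ cong (_+ s) eq ⟩
    (ℕ→ℚ e - t) + s       <⟨ ℚ.+-mono-≤-< (e-t≤e) s<1 ⟩
    ℕ→ℚ e + 1ℚ            ≡⟨ ℚ.+-comm (ℕ→ℚ e) 1ℚ ⟩
    1ℚ + ℕ→ℚ e            ≡⟨ ℕ→ℚ-suc e ⟨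
    ℕ→ℚ (suc e)           ∎))
    where
    open ℚ.≤-Reasoning
    split : ∀ x s → x ≡ (x - s) + s
    split = solve-∀ ℚ-ring
    e-t≤e : ℕ→ℚ e - t ≤ ℕ→ℚ e
    e-t≤e = subst (ℕ→ℚ e - t ≤_) (ℚ.+-identityʳ (ℕ→ℚ e)) (ℚ.+-monoʳ-≤ (ℕ→ℚ e) (ℚ.neg-antimono-≤ 0≤t))

  ncf-injective : ∀ {cs es} → All (2 ℕ.≤_) cs → All (2 ℕ.≤_) es → ncf cs ≡ ncf es → cs ≡ es
  ncf-injective []         []         _  = refl
  ncf-injective []         (q ∷ qs)   eq = ⊥-elim (ℚ.<-asym 0<1 (subst (1ℚ <_) (sym eq) (ncf>1 (q ∷ qs))) )
  ncf-injective (p ∷ ps)   []         eq = ⊥-elim (ℚ.<-asym 0<1 (subst (1ℚ <_) eq (ncf>1 (p ∷ ps))))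
  ncf-injective {c ∷ cs} {e ∷ es} (p ∷ ps) (q ∷ qs) eq =
    cong₂ _∷_ c≡e (ncf-injective ps qs tails)
    where
    s = inv (ncf cs)
    t = inv (ncf es)
    heads : ℕ→ℚ c - s ≡ ℕ→ℚ e - t
    heads = trans (sym (ncf-∷ c cs)) (trans eq (ncf-∷ e es))
    c≡e : c ≡ e
    c≡e = ℕ.≤-antisym (head-≤ heads (proj₂ (0≤inv-ncf<1 ps)) (proj₁ (0≤inv-ncf<1 qs)))
                      (head-≤ (sym heads) (proj₂ (0≤inv-ncf<1 qs)) (proj₁ (0≤inv-ncf<1 ps)))
    cancel : ∀ x s → s ≡ x - (x - s)
    cancel = solve-∀ ℚ-ring
    s≡t : s ≡ t
    s≡t = trans (cancel (ℕ→ℚ e) s) (trans (cong (λ z → ℕ→ℚ e - z) (trans (cong (λ n → ℕ→ℚ n - s) (sym c≡e)) heads)) (sym (cancel (ℕ→ℚ e) t)))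
    tails : ncf cs ≡ ncf es
    tails = trans (sym (inv-involutive (ncf cs))) (trans (cong inv s≡t) (inv-involutive (ncf es)))

  1+a-inv[1+inv[v]]≡a+inv[1+v] : ∀ a {v} → 0ℚ < v → ℕ→ℚ (suc a) - inv (1ℚ + inv v) ≡ ℕ→ℚ a + inv (1ℚ + v)
  1+a-inv[1+inv[v]]≡a+inv[1+v] a {v} 0<v = begin
    ℕ→ℚ (suc a) - inv (1ℚ + inv v)        ≡⟨ cong (_- inv (1ℚ + inv v)) (ℕ→ℚ-suc a) ⟩
    (1ℚ + ℕ→ℚ a) - inv (1ℚ + inv v)       ≡⟨ regroup (ℕ→ℚ a) (inv (1ℚ + inv v)) ⟩
    ℕ→ℚ a + (1ℚ - inv (1ℚ + inv v))       ≡⟨ cong (ℕ→ℚ a +_) (1-inv[1+inv[v]]≡inv[1+v] 0<v) ⟩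
    ℕ→ℚ a + inv (1ℚ + v)                  ∎
    where
    open ≡-Reasoning
    regroup : ∀ x y → (1ℚ + x) - y ≡ x + (1ℚ - y)
    regroup = solve-∀ ℚ-ring

  ncfWith-twos : ∀ k {u} → 0ℚ < u → ncfWith (twos k) (1ℚ + inv u) ≡ 1ℚ + inv (u + ℕ→ℚ k)
  ncfWith-twos zero    {u} _   = cong (λ z → 1ℚ + inv z) (sym (ℚ.+-identityʳ u))
  ncfWith-twos (suc k) {u} 0<u = begin
    ℕ→ℚ 2 - inv (ncfWith (twos k) (1ℚ + inv u))  ≡⟨ cong (λ z → ℕ→ℚ 2 - inv z) (ncfWith-twos k 0<u) ⟩
    ℕ→ℚ 2 - inv (1ℚ + inv (u + ℕ→ℚ k))          ≡⟨ 1+a-inv[1+inv[v]]≡a+inv[1+v] 1 (ℚ.+-mono-<-≤ 0<u (0≤ℕ→ℚ k)) ⟩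
    1ℚ + inv (1ℚ + (u + ℕ→ℚ k))                 ≡⟨ cong (λ z → 1ℚ + inv z) (swap u (ℕ→ℚ k)) ⟩
    1ℚ + inv (u + (1ℚ + ℕ→ℚ k))                 ≡⟨ cong (λ z → 1ℚ + inv (u + z)) (ℕ→ℚ-suc k) ⟨
    1ℚ + inv (u + ℕ→ℚ (suc k))                  ∎
    where
    open ≡-Reasoning
    swap : ∀ u k → 1ℚ + (u + k) ≡ u + (1ℚ + k)
    swap = solve-∀ ℚ-ring

  ncf-twos : ∀ k → ncf (twos (suc k)) ≡ 1ℚ + inv (ℕ→ℚ (suc k))
  ncf-twos zero    = refl
  ncf-twos (suc k) = begin
    ncf (2 ∷ twos (suc k))                    ≡⟨ ncf-∷ 2 (twos (suc k)) ⟩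
    ℕ→ℚ 2 - inv (ncf (twos (suc k)))          ≡⟨ cong (λ z → ℕ→ℚ 2 - inv z) (ncf-twos k) ⟩
    ℕ→ℚ 2 - inv (1ℚ + inv (ℕ→ℚ (suc k)))      ≡⟨ 1+a-inv[1+inv[v]]≡a+inv[1+v] 1 (0<ℕ→ℚ-suc k) ⟩
    1ℚ + inv (1ℚ + ℕ→ℚ (suc k))               ≡⟨ cong (λ z → 1ℚ + inv z) (ℕ→ℚ-suc (suc k)) ⟨
    1ℚ + inv (ℕ→ℚ (suc (suc k)))              ∎
    where open ≡-Reasoning

  ncf-∷-twos-++ : ∀ a k {ys u} → 0ℚ < u → ncf ys ≡ 1ℚ + inv u →
    ncf (suc a ∷ twos k ++ ys) ≡ ℕ→ℚ a + inv (ℕ→ℚ (suc k) + u)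
  ncf-∷-twos-++ a k {ys} {u} 0<u ys≡ = begin
    ncf (suc a ∷ twos k ++ ys)                        ≡⟨ ncf-∷ (suc a) (twos k ++ ys) ⟩
    ℕ→ℚ (suc a) - inv (ncf (twos k ++ ys))            ≡⟨ cong (λ z → ℕ→ℚ (suc a) - inv z) (ncf-++ (twos k) ys) ⟩
    ℕ→ℚ (suc a) - inv (ncfWith (twos k) (ncf ys))     ≡⟨ cong (λ z → ℕ→ℚ (suc a) - inv (ncfWith (twos k) z)) ys≡ ⟩
    ℕ→ℚ (suc a) - inv (ncfWith (twos k) (1ℚ + inv u)) ≡⟨ cong (λ z → ℕ→ℚ (suc a) - inv z) (ncfWith-twos k 0<u) ⟩
    ℕ→ℚ (suc a) - inv (1ℚ + inv (u + ℕ→ℚ k))         ≡⟨ 1+a-inv[1+inv[v]]≡a+inv[1+v] a (ℚ.+-mono-<-≤ 0<u (0≤ℕ→ℚ k)) ⟩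
    ℕ→ℚ a + inv (1ℚ + (u + ℕ→ℚ k))                   ≡⟨ cong (λ z → ℕ→ℚ a + inv z) (regroup u (ℕ→ℚ k)) ⟩
    ℕ→ℚ a + inv ((1ℚ + ℕ→ℚ k) + u)                   ≡⟨ cong (λ z → ℕ→ℚ a + inv (z + u)) (ℕ→ℚ-suc k) ⟨
    ℕ→ℚ a + inv (ℕ→ℚ (suc k) + u)                    ∎
    where
    open ≡-Reasoning
    regroup : ∀ u k → 1ℚ + (u + k) ≡ (1ℚ + k) + u
    regroup = solve-∀ ℚ-ring

  ncf-∷-twos-bump-negativeExpansion : ∀ a k {r} (e : EvenPositive r) →
    ncf (suc a ∷ twos k ++ bump (negativeExpansion e)) ≡ ℕ→ℚ a + inv (cf (suc k ∷ r))
  ncf-∷-twos-bump-negativeExpansion a zero    []  = trans (ℕ→ℚ-suc a) (ℚ.+-comm 1ℚ (ℕ→ℚ a))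
  ncf-∷-twos-bump-negativeExpansion a (suc k) []  = begin
    ncf (suc a ∷ twos (suc k) ++ [])               ≡⟨ cong (λ cs → ncf (suc a ∷ cs)) (++-identityʳ (twos (suc k))) ⟩
    ncf (suc a ∷ twos (suc k))                     ≡⟨ ncf-∷ (suc a) (twos (suc k)) ⟩
    ℕ→ℚ (suc a) - inv (ncf (twos (suc k)))         ≡⟨ cong (λ z → ℕ→ℚ (suc a) - inv z) (ncf-twos k) ⟩
    ℕ→ℚ (suc a) - inv (1ℚ + inv (ℕ→ℚ (suc k)))     ≡⟨ 1+a-inv[1+inv[v]]≡a+inv[1+v] a (0<ℕ→ℚ-suc k) ⟩
    ℕ→ℚ a + inv (1ℚ + ℕ→ℚ (suc k))                 ≡⟨ cong (λ z → ℕ→ℚ a + inv z) (ℕ→ℚ-suc (suc k)) ⟨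
    ℕ→ℚ a + inv (ℕ→ℚ (suc (suc k)))                ∎
    where open ≡-Reasoning
  ncf-∷-twos-bump-negativeExpansion a k {r} (⟨_,_⟩∷_ x y {r′} e′) = begin
    ncf (suc a ∷ twos k ++ bump (negativeExpansion (⟨ x , y ⟩∷ e′)))  ≡⟨ ncf-∷-twos-++ a k 0<u tail≡ ⟩
    ℕ→ℚ a + inv (ℕ→ℚ (suc k) + inv (cf r))                            ≡⟨ cong (λ z → ℕ→ℚ a + inv z) (cf-∷ (suc k) r) ⟨
    ℕ→ℚ a + inv (cf (suc k ∷ r))                                       ∎
    where
    open ≡-Reasoning
    0<u : 0ℚ < inv (cf r)
    0<u = inv-pos (cf-pos x (suc y ∷ r′))
    tail≡ : ncf (bump (negativeExpansion (⟨ x , y ⟩∷ e′))) ≡ 1ℚ + inv (inv (cf r))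
    tail≡ = trans (ncf-bump (suc (suc x)) (twos y ++ bump (negativeExpansion e′))) (cong (λ z → 1ℚ + z)
              (trans (ncf-∷-twos-bump-negativeExpansion (suc x) y e′) (sym (inv-involutive (cf r)))))

  ncf-negativeExpansion : ∀ {as} (e : EvenPositive as) → ncf (negativeExpansion e) ≡ cf as
  ncf-negativeExpansion []           = refl
  ncf-negativeExpansion (⟨ a , b ⟩∷ e) = ncf-∷-twos-bump-negativeExpansion (suc a) b e

module Matrices {c ℓ : Level} (R : CommutativeRing c ℓ) where

  import Defs as D
  open D using (Mat2; mat)
  open import Data.Integer using (0ℤ; 1ℤ)
  open import Data.Product using (_,_)
  open import Relation.Binary.Bundles using (Setoid)
  open import Relation.Binary.Structures using (IsEquivalence)
  open CommutativeRing R
  open ℤ-CoefficientRingSolver R using (solve; _:=_; con; _:+_; _:*_)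

  infix  4 _≈M_
  infixl 7 _⊗_
  infixr 8 _·_

  _≈M_ : Mat2 R → Mat2 R → Set ℓ
  _≈M_ = D._≈M_ R

  _⊗_ : Mat2 R → Mat2 R → Mat2 R
  _⊗_ = D._⊗_ R

  _·_ : Carrier → Mat2 R → Mat2 R
  _·_ = D._·_ R

  I₂ : Mat2 R
  I₂ = D.I₂ R

  ≈M-isEquivalence : IsEquivalence _≈M_
  ≈M-isEquivalence = record
    { refl  = refl , refl , refl , refl
    ; sym   = λ (a , b , c , d) → sym a , sym b , sym c , sym d
    ; trans = λ (a , b , c , d) (a′ , b′ , c′ , d′) → trans a a′ , trans b b′ , trans c c′ , trans d d′
    }

  ≈M-setoid : Setoid c ℓ
  ≈M-setoid = record { isEquivalence = ≈M-isEquivalence }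

  open IsEquivalence ≈M-isEquivalence public using () renaming (refl to ≈M-refl; sym to ≈M-sym; trans to ≈M-trans)

  ⊗-cong : ∀ {A A′ B B′} → A ≈M A′ → B ≈M B′ → A ⊗ B ≈M A′ ⊗ B′
  ⊗-cong (a , b , c , d) (a′ , b′ , c′ , d′) =
    +-cong (*-cong a a′) (*-cong b c′) , +-cong (*-cong a b′) (*-cong b d′) ,
    +-cong (*-cong c a′) (*-cong d c′) , +-cong (*-cong c b′) (*-cong d d′)

  ⊗-assoc : ∀ A B C → (A ⊗ B) ⊗ C ≈M A ⊗ (B ⊗ C)
  ⊗-assoc (mat a b c d) (mat e f g h) (mat x y z w) =
    entry a b x z , entry a b y w , entry c d x z , entry c d y w
    where
    entry : ∀ a b x z → (a * e + b * g) * x + (a * f + b * h) * z ≈ a * (e * x + f * z) + b * (g * x + h * z)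
    entry = solve 8 (λ e f g h a b x z →
      (a :* e :+ b :* g) :* x :+ (a :* f :+ b :* h) :* z := a :* (e :* x :+ f :* z) :+ b :* (g :* x :+ h :* z)) refl
      e f g h

  ⊗-identityˡ : ∀ A → I₂ ⊗ A ≈M A
  ⊗-identityˡ (mat a b c d) = top a c , top b d , bottom a c , bottom b d
    where
    top : ∀ x y → 1# * x + 0# * y ≈ x
    top = solve 2 (λ x y → con 1ℤ :* x :+ con 0ℤ :* y := x) refl
    bottom : ∀ x y → 0# * x + 1# * y ≈ y
    bottom = solve 2 (λ x y → con 0ℤ :* x :+ con 1ℤ :* y := y) refl

  ·-congʳ : ∀ {x y} A → x ≈ y → x · A ≈M y · A
  ·-congʳ A x≈y = *-congʳ x≈y , *-congʳ x≈y , *-congʳ x≈y , *-congʳ x≈y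

  *-·-⊗ : ∀ x y A B → (x * y) · (A ⊗ B) ≈M (x · A) ⊗ (y · B)
  *-·-⊗ x y (mat a b c d) (mat e f g h) = entry a b e g , entry a b f h , entry c d e g , entry c d f h
    where
    entry : ∀ a b e g → (x * y) * (a * e + b * g) ≈ (x * a) * (y * e) + (x * b) * (y * g)
    entry = solve 6 (λ x y a b e g → (x :* y) :* (a :* e :+ b :* g) := (x :* a) :* (y :* e) :+ (x :* b) :* (y :* g)) refl
      x y

module QIntegers {c ℓ : Level} (R : CommutativeRing c ℓ) where

  import Defs as D
  open import Data.Nat as ℕ using (ℕ; zero; suc)
  open import Data.Integer using (0ℤ; 1ℤ)
  open CommutativeRing R
  open ℤ-CoefficientRingSolver R using (solve; _:=_; con; _:+_; _:*_)
  open import Relation.Binary.Reasoning.Setoid setoid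

  pow : Carrier → ℕ → Carrier
  pow = D.pow R

  qint : Carrier → ℕ → Carrier
  qint = D.qint R

  pow-+ : ∀ x m n → pow x (m ℕ.+ n) ≈ pow x m * pow x n
  pow-+ x zero    n = sym (*-identityˡ _)
  pow-+ x (suc m) n = trans (*-congˡ (pow-+ x m n)) (sym (*-assoc _ _ _))

  qint-suc : ∀ x n → qint x (suc n) ≈ 1# + x * qint x n
  qint-suc x zero    = solve 1 (λ x → con 0ℤ :+ con 1ℤ := con 1ℤ :+ x :* con 0ℤ) refl x
  qint-suc x (suc n) = begin
    qint x (suc n) + pow x (suc n)      ≈⟨ +-congʳ (qint-suc x n) ⟩
    (1# + x * qint x n) + x * pow x n   ≈⟨ regroup x (qint x n) (pow x n) ⟩
    1# + x * qint x (suc n)             ∎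
    where
    regroup : ∀ x k p → (1# + x * k) + x * p ≈ 1# + x * (k + p)
    regroup = solve 3 (λ x k p → (con 1ℤ :+ x :* k) :+ x :* p := con 1ℤ :+ x :* (k :+ p)) refl

module QMatrixIdentities {c ℓ : Level} (R : CommutativeRing c ℓ) (q qinv : CommutativeRing.Carrier R)
                 (q*qinv≈1 : CommutativeRing._≈_ R (CommutativeRing._*_ R q qinv) (CommutativeRing.1# R)) where

  import Defs as D
  open D using (Mat2; mat)
  open Expansions
  open Matrices R
  open QIntegers R
  open import Data.Nat as ℕ using (ℕ; zero; suc)
  open import Data.Integer using (0ℤ; 1ℤ)
  open import Data.List using (List; []; _∷_; _++_)
  open import Data.Product using (_,_)
  open CommutativeRing R
  open ℤ-CoefficientRingSolver R using (solve; _:=_; con; _:+_; _:*_; :-_)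
  import Relation.Binary.Reasoning.Setoid as SetoidReasoning
  module ≈-Reasoning = SetoidReasoning setoid
  module ≈M-Reasoning = SetoidReasoning ≈M-setoid

  Rq : Mat2 R
  Rq = D.Rq R q qinv

  Mq : List ℕ → Mat2 R
  Mq = D.Mq R q qinv

  Mtplus : List ℕ → Mat2 R
  Mtplus = D.Mtplus R q qinv

  pow-inverse : ∀ n → pow q n * pow qinv n ≈ 1#
  pow-inverse zero    = *-identityˡ 1#
  pow-inverse (suc n) = begin
    (q * pow q n) * (qinv * pow qinv n)  ≈⟨ interchange q qinv (pow q n) (pow qinv n) ⟩
    (q * qinv) * (pow q n * pow qinv n)  ≈⟨ *-cong q*qinv≈1 (pow-inverse n) ⟩
    1# * 1#                              ≈⟨ *-identityˡ 1# ⟩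
    1#                                   ∎
    where
    open ≈-Reasoning
    interchange : ∀ q r x y → (q * x) * (r * y) ≈ (q * r) * (x * y)
    interchange = solve 4 (λ q r x y → (q :* x) :* (r :* y) := (q :* r) :* (x :* y)) refl

  pow-*-qint-inverse : ∀ n → pow q n * qint qinv n ≈ q * qint q n
  pow-*-qint-inverse zero    = trans (zeroʳ _) (sym (zeroʳ q))
  pow-*-qint-inverse (suc n) = begin
    (q * pow q n) * (qint qinv n + pow qinv n)
      ≈⟨ distribute q (pow q n) (qint qinv n) (pow qinv n) ⟩
    q * (pow q n * qint qinv n) + q * (pow q n * pow qinv n)
      ≈⟨ +-cong (*-congˡ (pow-*-qint-inverse n)) (*-congˡ (pow-inverse n)) ⟩
    q * (q * qint q n) + q * 1#
      ≈⟨ factor q (qint q n) ⟩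
    q * (1# + q * qint q n)
      ≈⟨ *-congˡ (qint-suc q n) ⟨
    q * qint q (suc n)
      ∎
    where
    open ≈-Reasoning
    distribute : ∀ q p i w → (q * p) * (i + w) ≈ q * (p * i) + q * (p * w)
    distribute = solve 4 (λ q p i w → (q :* p) :* (i :+ w) := q :* (p :* i) :+ q :* (p :* w)) refl
    factor : ∀ q k → q * (q * k) + q * 1# ≈ q * (1# + q * k)
    factor = solve 2 (λ q k → q :* (q :* k) :+ q :* con 1ℤ := q :* (con 1ℤ :+ q :* k)) refl

  Mq-++ : ∀ xs ys → Mq (xs ++ ys) ≈M Mq xs ⊗ Mq ys
  Mq-++ []       ys = ≈M-sym (⊗-identityˡ (Mq ys))
  Mq-++ (x ∷ xs) ys = begin
    X ⊗ Mq (xs ++ ys)     ≈⟨ ⊗-cong ≈M-refl (Mq-++ xs ys) ⟩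
    X ⊗ (Mq xs ⊗ Mq ys)   ≈⟨ ⊗-assoc X (Mq xs) (Mq ys) ⟨
    X ⊗ Mq xs ⊗ Mq ys     ∎
    where
    open ≈M-Reasoning
    X = mat (qint q x) (- pow q (x ℕ.∸ 1)) 1# 0#

  Rq-⊗-Mq : ∀ c cs → Rq ⊗ Mq (suc c ∷ cs) ≈M Mq (suc (suc c) ∷ cs)
  Rq-⊗-Mq c cs = begin
    Rq ⊗ (C ⊗ Mq cs)    ≈⟨ ⊗-assoc Rq C (Mq cs) ⟨
    Rq ⊗ C ⊗ Mq cs      ≈⟨ ⊗-cong Rq⊗C ≈M-refl ⟩
    C′ ⊗ Mq cs          ∎
    where
    open ≈M-Reasoning
    C  = mat (qint q (suc c)) (- pow q c) 1# 0#
    C′ = mat (qint q (suc (suc c))) (- pow q (suc c)) 1# 0#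
    Rq⊗C : Rq ⊗ C ≈M C′
    Rq⊗C =
      trans (solve 2 (λ q k → q :* k :+ con 1ℤ :* con 1ℤ := con 1ℤ :+ q :* k) refl q (qint q (suc c)))
            (sym (qint-suc q (suc c))) ,
      solve 2 (λ q p → q :* (:- p) :+ con 1ℤ :* con 0ℤ := :- (q :* p)) refl q (pow q c) ,
      solve 1 (λ k → con 0ℤ :* k :+ con 1ℤ :* con 1ℤ := con 1ℤ) refl (qint q (suc c)) ,
      solve 1 (λ p → con 0ℤ :* (:- p) :+ con 1ℤ :* con 0ℤ := con 0ℤ) refl (pow q c)

  Mq-twos-⊗-Rq : ∀ k → Mq (twos k) ⊗ Rq ≈M mat (q * qint q (suc k)) 1# (q * qint q k) 1#
  Mq-twos-⊗-Rq zero =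
    solve 1 (λ q → con 1ℤ :* q :+ con 0ℤ :* con 0ℤ := q :* (con 0ℤ :+ con 1ℤ)) refl q ,
    solve 0 (con 1ℤ :* con 1ℤ :+ con 0ℤ :* con 1ℤ := con 1ℤ) refl ,
    solve 1 (λ q → con 0ℤ :* q :+ con 1ℤ :* con 0ℤ := q :* con 0ℤ) refl q ,
    solve 0 (con 0ℤ :* con 1ℤ :+ con 1ℤ :* con 1ℤ := con 1ℤ) refl
  Mq-twos-⊗-Rq (suc k) = begin
    C₂ ⊗ Mq (twos k) ⊗ Rq                   ≈⟨ ⊗-assoc C₂ (Mq (twos k)) Rq ⟩
    C₂ ⊗ (Mq (twos k) ⊗ Rq)                 ≈⟨ ⊗-cong ≈M-refl (Mq-twos-⊗-Rq k) ⟩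
    C₂ ⊗ mat (q * (K + P)) 1# (q * K) 1#   ≈⟨ entries ⟩
    mat (q * ((K + P) + q * P)) 1# (q * (K + P)) 1# ∎
    where
    open ≈M-Reasoning
    C₂ = mat (qint q 2) (- pow q 1) 1# 0#
    K = qint q k
    P = pow q k
    entries : C₂ ⊗ mat (q * (K + P)) 1# (q * K) 1# ≈M mat (q * ((K + P) + q * P)) 1# (q * (K + P)) 1#
    entries =
      solve 3 (λ q K P → ((con 0ℤ :+ con 1ℤ) :+ q :* con 1ℤ) :* (q :* (K :+ P)) :+ (:- (q :* con 1ℤ)) :* (q :* K)
                          := q :* ((K :+ P) :+ q :* P)) refl q K P ,
      solve 1 (λ q → ((con 0ℤ :+ con 1ℤ) :+ q :* con 1ℤ) :* con 1ℤ :+ (:- (q :* con 1ℤ)) :* con 1ℤ := con 1ℤ) refl q ,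
      solve 3 (λ q K P → con 1ℤ :* (q :* (K :+ P)) :+ con 0ℤ :* (q :* K) := q :* (K :+ P)) refl q K P ,
      solve 0 (con 1ℤ :* con 1ℤ :+ con 0ℤ :* con 1ℤ := con 1ℤ) refl

  pair-factorisation : ∀ a k →
    pow q (suc k) · (mat (qint q a) (pow q a) 1# 0# ⊗ mat (qint qinv (suc k)) (pow qinv (suc k)) 1# 0#)
      ≈M Mq (suc a ∷ twos k) ⊗ Rq
  pair-factorisation a k = begin
    Q · (mat A B 1# 0# ⊗ mat I W 1# 0#)          ≈⟨ entries ⟩
    C ⊗ mat (q * (K + P)) 1# (q * K) 1#         ≈⟨ ⊗-cong ≈M-refl (Mq-twos-⊗-Rq k) ⟨
    C ⊗ (Mq (twos k) ⊗ Rq)                      ≈⟨ ⊗-assoc C (Mq (twos k)) Rq ⟨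
    C ⊗ Mq (twos k) ⊗ Rq                        ∎
    where
    open ≈M-Reasoning
    A = qint q a
    B = pow q a
    K = qint q k
    P = pow q k
    Q = pow q (suc k)
    I = qint qinv (suc k)
    W = pow qinv (suc k)
    C = mat (A + B) (- B) 1# 0#
    QI≈q[k+1] : Q * I ≈ q * (K + P)
    QI≈q[k+1] = pow-*-qint-inverse (suc k)
    QW≈1 : Q * W ≈ 1#
    QW≈1 = pow-inverse (suc k)
    entries : Q · (mat A B 1# 0# ⊗ mat I W 1# 0#) ≈M C ⊗ mat (q * (K + P)) 1# (q * K) 1#
    entries = top-left , top-right , bottom-left , bottom-right
      where
      top-left : Q * (A * I + B * 1#) ≈ (A + B) * (q * (K + P)) + (- B) * (q * K)
      top-left =
        trans (solve 4 (λ Q A B I → Q :* (A :* I :+ B :* con 1ℤ) := A :* (Q :* I) :+ B :* Q) refl Q A B I)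
        (trans (+-congʳ (*-congˡ QI≈q[k+1]))
        (solve 5 (λ q A B K P → A :* (q :* (K :+ P)) :+ B :* (q :* P) := (A :+ B) :* (q :* (K :+ P)) :+ (:- B) :* (q :* K))
               refl q A B K P))
      top-right : Q * (A * W + B * 0#) ≈ (A + B) * 1# + (- B) * 1#
      top-right =
        trans (solve 4 (λ Q A B W → Q :* (A :* W :+ B :* con 0ℤ) := A :* (Q :* W)) refl Q A B W)
        (trans (*-congˡ QW≈1)
        (solve 2 (λ A B → A :* con 1ℤ := (A :+ B) :* con 1ℤ :+ (:- B) :* con 1ℤ) refl A B))
      bottom-left : Q * (1# * I + 0# * 1#) ≈ 1# * (q * (K + P)) + 0# * (q * K)
      bottom-left =
        trans (solve 2 (λ Q I → Q :* (con 1ℤ :* I :+ con 0ℤ :* con 1ℤ) := Q :* I) refl Q I)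
        (trans QI≈q[k+1] (solve 2 (λ X Y → X := con 1ℤ :* X :+ con 0ℤ :* Y) refl (q * (K + P)) (q * K)))
      bottom-right : Q * (1# * W + 0# * 0#) ≈ 1# * 1# + 0# * 1#
      bottom-right =
        trans (solve 2 (λ Q W → Q :* (con 1ℤ :* W :+ con 0ℤ :* con 0ℤ) := Q :* W) refl Q W)
        (trans QW≈1 (solve 0 (con 1ℤ := con 1ℤ :* con 1ℤ :+ con 0ℤ :* con 1ℤ) refl))

  Mtplus-∷∷ : ∀ a b r →
    Mtplus (a ∷ b ∷ r) ≈M (pow q b · (mat (qint q a) (pow q a) 1# 0# ⊗ mat (qint qinv b) (pow qinv b) 1# 0#)) ⊗ Mtplus r
  Mtplus-∷∷ a b r = ≈M-trans (·-congʳ _ (pow-+ q b _)) (*-·-⊗ (pow q b) _ _ _)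

  Mtplus-negativeExpansion : ∀ a b {r} (e : EvenPositive r) →
    Mtplus (suc a ∷ suc b ∷ r) ≈M Mq (negativeExpansion (⟨ a , b ⟩∷ e)) ⊗ Rq
  Rq-⊗-Mtplus : ∀ {r} (e : EvenPositive r) → Rq ⊗ Mtplus r ≈M Mq (bump (negativeExpansion e)) ⊗ Rq

  Mtplus-negativeExpansion a b {r} e = begin
    Mtplus (suc a ∷ suc b ∷ r)                ≈⟨ Mtplus-∷∷ (suc a) (suc b) r ⟩
    _ ⊗ Mtplus r                              ≈⟨ ⊗-cong (pair-factorisation (suc a) b) ≈M-refl ⟩
    H ⊗ Rq ⊗ Mtplus r                          ≈⟨ ⊗-assoc H Rq (Mtplus r) ⟩
    H ⊗ (Rq ⊗ Mtplus r)                        ≈⟨ ⊗-cong ≈M-refl (Rq-⊗-Mtplus e) ⟩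
    H ⊗ (Mq T ⊗ Rq)                            ≈⟨ ⊗-assoc H (Mq T) Rq ⟨
    H ⊗ Mq T ⊗ Rq                              ≈⟨ ⊗-cong (Mq-++ (suc (suc a) ∷ twos b) T) ≈M-refl ⟨
    Mq (negativeExpansion (⟨ a , b ⟩∷ e)) ⊗ Rq ∎
    where
    open ≈M-Reasoning
    H = Mq (suc (suc a) ∷ twos b)
    T = bump (negativeExpansion e)

  Rq-⊗-Mtplus [] =
    solve 1 (λ q → q :* (con 1ℤ :* con 1ℤ) :+ con 1ℤ :* (con 1ℤ :* con 0ℤ) := con 1ℤ :* q :+ con 0ℤ :* con 0ℤ) refl q ,
    solve 1 (λ q → q :* (con 1ℤ :* con 0ℤ) :+ con 1ℤ :* (con 1ℤ :* con 1ℤ) := con 1ℤ :* con 1ℤ :+ con 0ℤ :* con 1ℤ) refl q ,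
    solve 1 (λ q → con 0ℤ :* (con 1ℤ :* con 1ℤ) :+ con 1ℤ :* (con 1ℤ :* con 0ℤ) := con 0ℤ :* q :+ con 1ℤ :* con 0ℤ) refl q ,
    solve 1 (λ q → con 0ℤ :* (con 1ℤ :* con 0ℤ) :+ con 1ℤ :* (con 1ℤ :* con 1ℤ) := con 0ℤ :* con 1ℤ :+ con 1ℤ :* con 1ℤ) refl q
  Rq-⊗-Mtplus (⟨_,_⟩∷_ a b {r} e) = begin
    Rq ⊗ Mtplus (suc a ∷ suc b ∷ r)            ≈⟨ ⊗-cong ≈M-refl (Mtplus-negativeExpansion a b e) ⟩
    Rq ⊗ (Mq N ⊗ Rq)                           ≈⟨ ⊗-assoc Rq (Mq N) Rq ⟨
    Rq ⊗ Mq N ⊗ Rq                             ≈⟨ ⊗-cong (Rq-⊗-Mq (suc a) (twos b ++ bump (negativeExpansion e))) ≈M-refl ⟩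
    Mq (bump N) ⊗ Rq                           ∎
    where
    open ≈M-Reasoning
    N = negativeExpansion (⟨ a , b ⟩∷ e)

open import Defs
open import Data.Nat using (ℕ; _≤_; _*_)
open import Data.List using (List; length)
open import Data.List.Relation.Unary.All using (All)
open import Data.Product using (∃; _×_)
open import Relation.Binary.PropositionalEquality using (_≡_)
open import Data.Rational using (ℚ; 1ℚ; _<_)

open import Data.Nat using (s≤s)
open import Data.Product using (_,_)
open import Relation.Binary.PropositionalEquality using (subst; sym; trans)
open Expansions using ([]; ⟨_,_⟩∷_; evenPositive; negativeExpansion; negativeExpansion-≥2)
open ContinuedFractionValues using (ncf-injective; ncf-negativeExpansion)

proposition4p9 : {c ℓ : Level} (R : CommutativeRing c ℓ)
    (q qinv : CommutativeRing.Carrier R)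
    → CommutativeRing._≈_ R (CommutativeRing._*_ R q qinv) (CommutativeRing.1# R)
    → (x : ℚ) → 1ℚ < x
    → (as : List ℕ) → ∃ (λ m → 1 ≤ m × length as ≡ 2 * m) → All (1 ≤_) as → cf as ≡ x
    → (cs : List ℕ) → 1 ≤ length cs → All (2 ≤_) cs → ncf cs ≡ x
    → _≈M_ R (Mtplus R q qinv as) (_⊗_ R (Mq R q qinv cs) (Rq R q qinv))
proposition4p9 R q qinv q*qinv≈1 x _ as (m , 1≤m , len) as≥1 cf≡x cs _ cs≥2 ncf≡x
  with evenPositive m as len as≥1 | 1≤m | len
... | []           | s≤s _ | ()
... | ⟨ a , b ⟩∷ e | _     | _  =
  subst (λ ds → _≈M_ R (Mtplus R q qinv as) (_⊗_ R (Mq R q qinv ds) (Rq R q qinv)))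
        (sym cs≡negativeExpansion)
        (QMatrixIdentities.Mtplus-negativeExpansion R q qinv q*qinv≈1 a b e)
  where
  cs≡negativeExpansion : cs ≡ negativeExpansion (⟨ a , b ⟩∷ e)
  cs≡negativeExpansion = ncf-injective cs≥2 (negativeExpansion-≥2 (⟨ a , b ⟩∷ e))
    (trans ncf≡x (trans (sym cf≡x) (sym (ncf-negativeExpansion (⟨ a , b ⟩∷ e)))))
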